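{- Let $\mathcal{K}_1$ be a consistent $\mathcal{ALC}$ knowledge base, $\mathcal{K}_2$ a consistent Horn-$\mathcal{ALC}$ knowledge base, and $\Sigma$ a signature. Then $\mathcal{K}_1$ $\Sigma$-UCQ entails $\mathcal{K}_2$ if and only if $\mathcal{K}_1$ $\Sigma$-CQ entails $\mathcal{K}_2$. Likewise, $\mathcal{K}_1$ $\Sigma$-rUCQ entails $\mathcal{K}_2$ if and only if $\mathcal{K}_1$ $\Sigma$-rCQ entails $\mathcal{K}_2$. The same two equivalences hold for TBox entailment: for an $\mathcal{ALC}$ TBox $\mathcal{T}_1$, a Horn-$\mathcal{ALC}$ TBox $\mathcal{T}_2$ and a pair of signatures $\Theta=(\Sigma_1,\Sigma_2)$, $\mathcal{T}_1$ $\Theta$-UCQ entails $\mathcal{T}_2$ iff $\mathcal{T}_1$ $\Theta$-CQ entails $\mathcal{T}_2$, and $\mathcal{T}_1$ $\Theta$-rUCQ entails $\mathcal{T}_2$ iff $\mathcal{T}_1$ $\Theta$-rCQ entails $\mathcal{T}_2$.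
   Context: $\mathcal{ALC}$ concepts are built from concept names $A$ and $\top$ using $\neg C$, $C_1\sqcap C_2$ and $\exists R.C$ ($R$ a role name); $\bot,\sqcup,\forall R.C$ are the usual abbreviations. A TBox is a finite set of concept inclusions $C\sqsubseteq D$. A TBox is Horn-$\mathcal{ALC}$ if no concept of the form $\neg C$ occurs negatively and no concept of the form $\exists R.\neg C$ occurs positively in it. An ABox is a finite set of assertions $A(a)$, $R(a,b)$ with individual names $a,b$; $\mathsf{ind}(\mathcal{A})$ is its set of individuals. A knowledge base (KB) is $\mathcal{K}=(\mathcal{T},\mathcal{A})$ with $\mathsf{ind}(\mathcal{K})=\mathsf{ind}(\mathcal{A})$; it is Horn-$\mathcal{ALC}$ if $\mathcal{T}$ is. Interpretations satisfy the standard name assumption $a^{\mathcal{I}}=a$. A conjunctive query (CQ) $q(\vec x)=\exists\vec y\,\varphi(\vec x,\vec y)$ with $\varphi$ a conjunction of atoms $A(z)$, $R(z,z')$ over variables in $\vec x,\vec y$; $\vec x$ are the answer variables. It is rooted (rCQ) if every $y\in\vec y$ is connected to some answer variable in the undirected graph whose edges are $\{u,v\}$ with $R(u,v)$ in $q$. A UCQ is a disjunction of CQs with the same answer variables; an rUCQ is a UCQ all of whose disjuncts are rooted. $\mathcal{K}\models q(\vec a)$ means $\mathcal{I}\models q(\vec a)$ for every model $\mathcal{I}$ of $\mathcal{K}$. A signature is a set of concept and role names; a $\Sigma$-query uses only symbols in $\Sigma$. For consistent KBs $\mathcal{K}_1,\mathcal{K}_2$ and a class $\mathcal{Q}\in\{$CQ,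 rCQ, UCQ, rUCQ$\}$, $\mathcal{K}_1$ $\Sigma$-$\mathcal{Q}$ entails $\mathcal{K}_2$ if for every $\Sigma$-query $q(\vec x)$ in $\mathcal{Q}$ and every tuple $\vec a$ from $\mathsf{ind}(\mathcal{K}_2)$, $\mathcal{K}_2\models q(\vec a)$ implies $\vec a\subseteq\mathsf{ind}(\mathcal{K}_1)$ and $\mathcal{K}_1\models q(\vec a)$. For TBoxes $\mathcal{T}_1,\mathcal{T}_2$ and $\Theta=(\Sigma_1,\Sigma_2)$, $\mathcal{T}_1$ $\Theta$-$\mathcal{Q}$ entails $\mathcal{T}_2$ if for every ABox $\mathcal{A}$ using only symbols from $\Sigma_1$ that is consistent with both $\mathcal{T}_1$ and $\mathcal{T}_2$, the KB $(\mathcal{T}_1,\mathcal{A})$ $\Sigma_2$-$\mathcal{Q}$ entails $(\mathcal{T}_2,\mathcal{A})$. -}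

module Defs where

open import Data.Nat using (ℕ)
open import Data.Fin using (Fin)
open import Data.Sum using (_⊎_; inj₁; inj₂)
open import Data.Product using (Σ; ∃; _×_; _,_)
open import Data.Unit using (⊤)
open import Data.Empty using (⊥)
open import Data.List using (List)
open import Data.List.NonEmpty using (List⁺; toList)
open import Data.List.Membership.Propositional using (_∈_)
open import Data.List.Relation.Unary.All using (All)
open import Data.List.Relation.Unary.Any using (Any)
open import Relation.Nullary using (¬_)
open import Relation.Binary.PropositionalEquality using (_≡_)
open import Relation.Binary.Construct.Closure.ReflexiveTransitive using (Star)
open import Function.Definitions using (Injective)
open import Function.Bundles using (_⇔_)

ConceptName RoleName IndName : Set
ConceptName = ℕ
RoleName = ℕ
IndName = ℕ

-- ALC concepts (⊥, ⊔, ∀ are abbreviations, as in the paper)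

infixr 7 _⊓_
data Concept : Set where
  ⊤ᶜ   : Concept
  atom : ConceptName → Concept
  ¬ᶜ_  : Concept → Concept
  _⊓_  : Concept → Concept → Concept
  ∃ᶜ   : RoleName → Concept → Concept

NotNegation : Concept → Set
NotNegation (¬ᶜ _) = ⊥
NotNegation _      = ⊤

-- Horn conditions on a concept occurring at positive / negative polarity:
-- no ¬C occurs negatively, no ∃R.¬C occurs positively.
mutual
  HornPos : Concept → Set
  HornPos ⊤ᶜ        = ⊤
  HornPos (atom _)  = ⊤
  HornPos (¬ᶜ C)    = HornNeg C
  HornPos (C ⊓ D)   = HornPos C × HornPos D
  HornPos (∃ᶜ R C)  = NotNegation C × HornPos C

  HornNeg : Concept → Set
  HornNeg ⊤ᶜ        = ⊤
  HornNeg (atom _)  = ⊤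
  HornNeg (¬ᶜ C)    = ⊥
  HornNeg (C ⊓ D)   = HornNeg C × HornNeg D
  HornNeg (∃ᶜ R C)  = HornNeg C

-- a concept inclusion C ⊑ D is the pair (C , D)
TBox : Set
TBox = List (Concept × Concept)

HornTBox : TBox → Set
HornTBox T = All (λ { (C , D) → HornNeg C × HornPos D }) T

data Assertion : Set where
  cAss : ConceptName → IndName → Assertion
  rAss : RoleName → IndName → IndName → Assertion

ABox : Set
ABox = List Assertion

record KB : Set where
  constructor ⟨_,_⟩
  field
    tbox : TBox
    abox : ABox
open KB public

data OccursIn (a : IndName) : Assertion → Set where
  inC  : ∀ {A} → OccursIn a (cAss A a)
  inR₁ : ∀ {R b} → OccursIn a (rAss R a b)
  inR₂ : ∀ {R b} → OccursIn a (rAss R b a)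

_∈indA_ : IndName → ABox → Set
a ∈indA 𝒜 = Any (OccursIn a) 𝒜

_∈ind_ : IndName → KB → Set
a ∈ind K = a ∈indA abox K

record Signature : Set₁ where
  field
    cnames : ConceptName → Set
    rnames : RoleName → Set
open Signature public

_-ABox_ : Signature → ABox → Set
S -ABox 𝒜 = All sigOK 𝒜
  where
    sigOK : Assertion → Set
    sigOK (cAss A _)   = cnames S A
    sigOK (rAss R _ _) = rnames S R

-- Interpretations (standard name assumption: individual names are
-- injectively embedded into the domain, a^I = a)

record Interpretation : Set₁ where
  field
    Δ    : Set
    conc : ConceptName → Δ → Set
    role : RoleName → Δ → Δ → Set
    ind  : IndName → Δ
    ind-injective : Injective _≡_ _≡_ ind
open Interpretation public

⟦_⟧ : Concept → (I : Interpretation) → Δ I → Set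
⟦ ⊤ᶜ ⟧ I d      = ⊤
⟦ atom A ⟧ I d  = conc I A d
⟦ ¬ᶜ C ⟧ I d    = ¬ (⟦ C ⟧ I d)
⟦ C ⊓ D ⟧ I d   = ⟦ C ⟧ I d × ⟦ D ⟧ I d
⟦ ∃ᶜ R C ⟧ I d  = Σ (Δ I) λ e → role I R d e × ⟦ C ⟧ I e

Classical : Interpretation → Set
Classical I = ∀ C d → ⟦ C ⟧ I d ⊎ ¬ (⟦ C ⟧ I d)

SatAssertion : Interpretation → Assertion → Set
SatAssertion I (cAss A a)   = conc I A (ind I a)
SatAssertion I (rAss R a b) = role I R (ind I a) (ind I b)

ModelOf : Interpretation → KB → Set
ModelOf I K =
  All (λ { (C , D) → ∀ d → ⟦ C ⟧ I d → ⟦ D ⟧ I d }) (tbox K)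
  × All (SatAssertion I) (abox K)

Consistent : KB → Set₁
Consistent K = Σ Interpretation λ I → Classical I × ModelOf I K

Var : ℕ → ℕ → Set
Var n m = Fin n ⊎ Fin m      -- inj₁ = answer variable, inj₂ = quantified

data QAtom (n m : ℕ) : Set where
  cAt : ConceptName → Var n m → QAtom n m
  rAt : RoleName → Var n m → Var n m → QAtom n m

record CQ (n : ℕ) : Set where
  field
    nq    : ℕ
    atoms : List (QAtom n nq)
open CQ public

Edge : ∀ {n} (q : CQ n) → Var n (nq q) → Var n (nq q) → Set
Edge q u v = Σ RoleName λ R → (rAt R u v ∈ atoms q) ⊎ (rAt R v u ∈ atoms q)

Rooted : ∀ {n} → CQ n → Set
Rooted {n} q = (y : Fin (nq q)) →
  Σ (Fin n) λ x → Star (Edge q) (inj₂ y) (inj₁ x)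

UCQ : ℕ → Set
UCQ n = List⁺ (CQ n)

RootedU : ∀ {n} → UCQ n → Set
RootedU q = All Rooted (toList q)

SigAtom : ∀ {n m} → Signature → QAtom n m → Set
SigAtom S (cAt A _)   = cnames S A
SigAtom S (rAt R _ _) = rnames S R

SigCQ : ∀ {n} → Signature → CQ n → Set
SigCQ S q = All (SigAtom S) (atoms q)

SigUCQ : ∀ {n} → Signature → UCQ n → Set
SigUCQ S q = All (SigCQ S) (toList q)

module _ (I : Interpretation) {n m : ℕ} (a : Fin n → IndName) (π : Fin m → Δ I) where
  val : Var n m → Δ I
  val (inj₁ x) = ind I (a x)
  val (inj₂ y) = π y

  SatAtom : QAtom n m → Set
  SatAtom (cAt A z)    = conc I A (val z)
  SatAtom (rAt R z z') = role I R (val z) (val z')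

SatCQ : (I : Interpretation) → ∀ {n} → CQ n → (Fin n → IndName) → Set
SatCQ I q a = Σ (Fin (nq q) → Δ I) λ π → All (SatAtom I a π) (atoms q)

SatUCQ : (I : Interpretation) → ∀ {n} → UCQ n → (Fin n → IndName) → Set
SatUCQ I q a = Any (λ c → SatCQ I c a) (toList q)

data QClass : Set where
  cq rcq ucq rucq : QClass

QueryT : QClass → ℕ → Set
QueryT cq   n = CQ n
QueryT rcq  n = Σ (CQ n) Rooted
QueryT ucq  n = UCQ n
QueryT rucq n = Σ (UCQ n) RootedU

SigQ : ∀ Q {n} → Signature → QueryT Q n → Set
SigQ cq   S q       = SigCQ S q
SigQ rcq  S (q , _) = SigCQ S q
SigQ ucq  S q       = SigUCQ S q
SigQ rucq S (q , _) = SigUCQ S q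

SatQ : ∀ Q → (I : Interpretation) → ∀ {n} → QueryT Q n → (Fin n → IndName) → Set
SatQ cq   I q       a = SatCQ I q a
SatQ rcq  I (q , _) a = SatCQ I q a
SatQ ucq  I q       a = SatUCQ I q a
SatQ rucq I (q , _) a = SatUCQ I q a

_⊨[_]_at_ : KB → ∀ Q {n} → QueryT Q n → (Fin n → IndName) → Set₁
K ⊨[ Q ] q at a = (I : Interpretation) → Classical I → ModelOf I K → SatQ Q I q a

KBEntails : QClass → KB → Signature → KB → Set₁
KBEntails Q K₁ S K₂ =
  ∀ {n} (q : QueryT Q n) → SigQ Q S q →
  (a : Fin n → IndName) → (∀ i → a i ∈ind K₂) →
  K₂ ⊨[ Q ] q at a →
  (∀ i → a i ∈ind K₁) × (K₁ ⊨[ Q ] q at a)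

TBoxEntails : QClass → TBox → Signature × Signature → TBox → Set₁
TBoxEntails Q T₁ (S₁ , S₂) T₂ =
  (𝒜 : ABox) → S₁ -ABox 𝒜 →
  Consistent ⟨ T₁ , 𝒜 ⟩ → Consistent ⟨ T₂ , 𝒜 ⟩ →
  KBEntails Q ⟨ T₁ , 𝒜 ⟩ S₂ ⟨ T₂ , 𝒜 ⟩

module Submission where

-- A CQ is a one-disjunct UCQ, so UCQ-entailment always implies CQ-entailment.
-- Conversely, a consistent Horn-ALC KB K has a canonical model. Saturate the finite
-- set of facts "n : C", where n is an individual of K or an anonymous witness of a
-- concept D and C ranges over the subconcepts of K, under rules that are sound in
-- every model of K; then unravel the witnesses into a forest-shaped interpretation M.
-- The Horn conditions make the truth lemma hold at both polarities (negative concepts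
-- true in M are derived, derived positive concepts are true in M, a derived ¬C
-- being excluded by a model of K), so M is a model of K, and the realisations of the
-- witnesses give a homomorphism from M into every model of K. Hence if K entails
-- q₁ ∨ … ∨ qₙ, the disjunct qᵢ satisfied in M is entailed by K, and CQ-entailment of
-- qᵢ transfers to the union. Rootedness passes to the disjuncts, and TBox entailment
-- is KB entailment for every ABox.

open import Defs
open import Data.Bool using (Bool; true; false; T; _∨_; if_then_else_)
open import Data.Bool.Properties using (T-∨)
open import Data.Empty using (⊥; ⊥-elim)
open import Data.Fin using (Fin)
open import Data.List using (List; []; _∷_; [_]; _++_; length; concatMap; cartesianProduct; map)
open import Data.List.NonEmpty using (toList) renaming ([_] to [_]⁺)
open import Data.List.Membership.Propositional using (_∈_; lose; find)
open import Data.List.Membership.Propositional.Properties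
  using (∈-++⁺ˡ; ∈-++⁺ʳ; ∈-++⁻; ∈-map⁺; ∈-concatMap⁺; ∈-concatMap⁻;
         ∈-cartesianProduct⁺; ∈-cartesianProduct⁻)
open import Data.List.Relation.Unary.All as All using (All; []; _∷_)
open import Data.List.Relation.Unary.Any as Any using (Any; here; there; any?)
open import Data.List.Relation.Unary.Any.Properties using (singleton⁺; singleton⁻)
open import Data.Nat as ℕ using (ℕ; zero; suc; _+_; _≤_; _<_; z≤n; s≤s)
open import Data.Nat.Properties
  using (m≤n⇒m≤1+n; m<n⇒m<1+n; <⇒≱; <-≤-trans; +-suc; +-monoʳ-≤; m≤m+n)
open import Data.Product as Σ using (Σ; ∃-syntax; _×_; _,_; proj₁; proj₂)
import Data.Product.Properties as Σₚ
open import Data.Sum as ⊎ using (_⊎_; inj₁; inj₂)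
import Data.Sum.Properties as ⊎ₚ
open import Data.Unit using (tt)
open import Function using (_∘_)
open import Function.Bundles using (_⇔_; mk⇔; Equivalence)
open import Relation.Binary.Definitions using (DecidableEquality)
open import Relation.Binary.PropositionalEquality using (_≡_; refl; sym; cong; subst; subst₂)
open import Relation.Nullary using (Dec; yes; no; ¬_; ¬?)
open import Relation.Nullary.Decidable
  using (_×-dec_; _⊎-dec_; map′; T?; isYes; toWitness; fromWitness)

module Saturation {X : Set} (_≟_ : DecidableEquality X) (L : List X)
                  (Derivable : (X → Bool) → X → Set)
                  (derivable? : ∀ S x → Dec (Derivable S x)) where

  open import Data.List.Membership.DecPropositional _≟_ using (_∈?_)

  _⊆_ : (X → Bool) → (X → Bool) → Set
  S ⊆ S′ = ∀ x → T (S x) → T (S′ x)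

  Closed : (X → Bool) → Set
  Closed S = ∀ {x} → x ∈ L → Derivable S x → T (S x)

  derivable-in-L? : ∀ S x → Dec (x ∈ L × Derivable S x)
  derivable-in-L? S x = x ∈? L ×-dec derivable? S x

  stage : ℕ → X → Bool
  stage zero    _ = false
  stage (suc k) x = stage k x ∨ isYes (derivable-in-L? (stage k) x)

  stage-⊆ : ∀ k → stage k ⊆ stage (suc k)
  stage-⊆ k x s = Equivalence.from T-∨ (inj₁ s)

  stage-step : ∀ k {x} → x ∈ L → Derivable (stage k) x → T (stage (suc k) x)
  stage-step k {x} x∈L d = Equivalence.from (T-∨ {stage k x}) (inj₂ (fromWitness (x∈L , d)))

  stage-cases : ∀ k {x} → T (stage (suc k) x) →
                T (stage k x) ⊎ (x ∈ L × Derivable (stage k) x)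
  stage-cases k {x} s = ⊎.map₂ toWitness (Equivalence.to (T-∨ {stage k x}) s)

  count : (X → Bool) → List X → ℕ
  count S []       = 0
  count S (x ∷ xs) = if S x then suc (count S xs) else count S xs

  count≤length : ∀ S xs → count S xs ≤ length xs
  count≤length S []       = z≤n
  count≤length S (x ∷ xs) with S x
  ... | true  = s≤s (count≤length S xs)
  ... | false = m≤n⇒m≤1+n (count≤length S xs)

  count-mono : ∀ {S S′} → S ⊆ S′ → ∀ xs → count S xs ≤ count S′ xs
  count-mono         S⊆S′ []       = z≤n
  count-mono {S} {S′} S⊆S′ (x ∷ xs) with S x | S′ x | S⊆S′ x
  ... | true  | true  | _   = s≤s (count-mono S⊆S′ xs)
  ... | true  | false | sub = ⊥-elim (sub _)
  ... | false | true  | _   = m≤n⇒m≤1+n (count-mono S⊆S′ xs)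
  ... | false | false | _   = count-mono S⊆S′ xs

  count-strict : ∀ {S S′} → S ⊆ S′ → ∀ {xs} →
                 Any (λ x → ¬ T (S x) × T (S′ x)) xs → count S xs < count S′ xs
  count-strict {S} {S′} S⊆S′ {x ∷ xs} (here (∉S , ∈S′)) with S x | S′ x
  ... | true  | _     = ⊥-elim (∉S _)
  ... | false | false = ⊥-elim ∈S′
  ... | false | true  = s≤s (count-mono S⊆S′ xs)
  count-strict {S} {S′} S⊆S′ {x ∷ xs} (there new) with S x | S′ x | S⊆S′ x
  ... | true  | true  | _   = s≤s (count-strict S⊆S′ new)
  ... | true  | false | sub = ⊥-elim (sub _)
  ... | false | true  | _   = m<n⇒m<1+n (count-strict S⊆S′ new)
  ... | false | false | _   = count-strict S⊆S′ new

  -- A stage that is not closed is followed by one with strictly more elements of L,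
  -- which can happen at most length L times.
  stabilise : ∀ fuel k → length L < fuel + count (stage k) L → Σ ℕ (Closed ∘ stage)
  stabilise zero       k lt = ⊥-elim (<⇒≱ lt (count≤length (stage k) L))
  stabilise (suc fuel) k lt with any? (λ x → ¬? (T? (stage k x)) ×-dec T? (stage (suc k) x)) L
  ... | yes new = stabilise fuel (suc k)
        (<-≤-trans (subst (length L <_) (sym (+-suc fuel _)) lt)
                   (+-monoʳ-≤ fuel (count-strict (stage-⊆ k) new)))
  ... | no none = k , closed
    where
      closed : Closed (stage k)
      closed {x} x∈L d with T? (stage k x)
      ... | yes s = s
      ... | no ∉S = ⊥-elim (none (lose x∈L (∉S , stage-step k x∈L d)))

  Preserved : ∀ {ℓ} → (X → Set ℓ) → Set ℓ
  Preserved P = ∀ S → (∀ x → T (S x) → P x) → ∀ {x} → x ∈ L → Derivable S x → P x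

  stage-induction : ∀ {ℓ} (P : X → Set ℓ) → Preserved P → ∀ k x → T (stage k x) → P x
  stage-induction P step (suc k) x s with stage-cases k s
  ... | inj₁ old        = stage-induction P step k x old
  ... | inj₂ (x∈L , d) = step (stage k) (stage-induction P step k) x∈L d

  saturation : Σ ℕ (Closed ∘ stage)
  saturation = stabilise (suc (length L)) 0 (s≤s (m≤m+n (length L) _))

  S* : X → Bool
  S* = stage (proj₁ saturation)

  S*-closed : Closed S*
  S*-closed = proj₂ saturation

  S*-induction : ∀ {ℓ} (P : X → Set ℓ) → Preserved P → ∀ x → T (S* x) → P x
  S*-induction P step = stage-induction P step (proj₁ saturation)

_≟ᶜ_ : DecidableEquality Concept
⊤ᶜ       ≟ᶜ ⊤ᶜ       = yes refl
atom A   ≟ᶜ atom B   with A ℕ.≟ B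
... | yes refl = yes refl
... | no A≢B   = no λ { refl → A≢B refl }
(¬ᶜ C)   ≟ᶜ (¬ᶜ D)   with C ≟ᶜ D
... | yes refl = yes refl
... | no C≢D   = no λ { refl → C≢D refl }
(C ⊓ D)  ≟ᶜ (E ⊓ F)  with C ≟ᶜ E | D ≟ᶜ F
... | yes refl | yes refl = yes refl
... | no C≢E   | _        = no λ { refl → C≢E refl }
... | _        | no D≢F   = no λ { refl → D≢F refl }
∃ᶜ R C   ≟ᶜ ∃ᶜ S D   with R ℕ.≟ S | C ≟ᶜ D
... | yes refl | yes refl = yes refl
... | no R≢S   | _        = no λ { refl → R≢S refl }
... | _        | no C≢D   = no λ { refl → C≢D refl }
⊤ᶜ       ≟ᶜ atom _   = no λ ()
⊤ᶜ       ≟ᶜ (¬ᶜ _)   = no λ ()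
⊤ᶜ       ≟ᶜ (_ ⊓ _)  = no λ ()
⊤ᶜ       ≟ᶜ ∃ᶜ _ _   = no λ ()
atom _   ≟ᶜ ⊤ᶜ       = no λ ()
atom _   ≟ᶜ (¬ᶜ _)   = no λ ()
atom _   ≟ᶜ (_ ⊓ _)  = no λ ()
atom _   ≟ᶜ ∃ᶜ _ _   = no λ ()
(¬ᶜ _)   ≟ᶜ ⊤ᶜ       = no λ ()
(¬ᶜ _)   ≟ᶜ atom _   = no λ ()
(¬ᶜ _)   ≟ᶜ (_ ⊓ _)  = no λ ()
(¬ᶜ _)   ≟ᶜ ∃ᶜ _ _   = no λ ()
(_ ⊓ _)  ≟ᶜ ⊤ᶜ       = no λ ()
(_ ⊓ _)  ≟ᶜ atom _   = no λ ()
(_ ⊓ _)  ≟ᶜ (¬ᶜ _)   = no λ ()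
(_ ⊓ _)  ≟ᶜ ∃ᶜ _ _   = no λ ()
∃ᶜ _ _   ≟ᶜ ⊤ᶜ       = no λ ()
∃ᶜ _ _   ≟ᶜ atom _   = no λ ()
∃ᶜ _ _   ≟ᶜ (¬ᶜ _)   = no λ ()
∃ᶜ _ _   ≟ᶜ (_ ⊓ _)  = no λ ()

_≟ᵃ_ : DecidableEquality Assertion
cAss A a   ≟ᵃ cAss B b   with A ℕ.≟ B | a ℕ.≟ b
... | yes refl | yes refl = yes refl
... | no A≢B   | _        = no λ { refl → A≢B refl }
... | _        | no a≢b   = no λ { refl → a≢b refl }
rAss R a b ≟ᵃ rAss S c d with R ℕ.≟ S | a ℕ.≟ c | b ℕ.≟ d
... | yes refl | yes refl | yes refl = yes refl
... | no R≢S   | _        | _        = no λ { refl → R≢S refl }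
... | _        | no a≢c   | _        = no λ { refl → a≢c refl }
... | _        | _        | no b≢d   = no λ { refl → b≢d refl }
cAss _ _   ≟ᵃ rAss _ _ _ = no λ ()
rAss _ _ _ ≟ᵃ cAss _ _   = no λ ()

open import Data.List.Membership.DecPropositional ℕ._≟_ using () renaming (_∈?_ to _∈ⁱ?_)
open import Data.List.Membership.DecPropositional _≟ᵃ_ using () renaming (_∈?_ to _∈ᵃ?_)

mutual
  subconcepts : Concept → List Concept
  subconcepts C = C ∷ strictSubconcepts C

  strictSubconcepts : Concept → List Concept
  strictSubconcepts ⊤ᶜ       = []
  strictSubconcepts (atom _) = []
  strictSubconcepts (¬ᶜ C)   = subconcepts C
  strictSubconcepts (C ⊓ D)  = subconcepts C ++ subconcepts D
  strictSubconcepts (∃ᶜ _ C) = subconcepts C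

subconcepts-trans : ∀ {C D} E → C ∈ subconcepts D → D ∈ subconcepts E → C ∈ subconcepts E
subconcepts-trans _        C∈D (here refl)   = C∈D
subconcepts-trans (¬ᶜ E)   C∈D (there D∈E)   = there (subconcepts-trans E C∈D D∈E)
subconcepts-trans (∃ᶜ _ E) C∈D (there D∈E)   = there (subconcepts-trans E C∈D D∈E)
subconcepts-trans (E ⊓ F)  C∈D (there D∈EF) with ∈-++⁻ (subconcepts E) D∈EF
... | inj₁ D∈E = there (∈-++⁺ˡ (subconcepts-trans E C∈D D∈E))
... | inj₂ D∈F = there (∈-++⁺ʳ (subconcepts E) (subconcepts-trans F C∈D D∈F))

closure : List Concept → List Concept
closure = concatMap subconcepts

⊆-closure : ∀ {C} Cs → C ∈ Cs → C ∈ closure Cs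
⊆-closure _ C∈Cs = ∈-concatMap⁺ subconcepts (Any.map (λ { refl → here refl }) C∈Cs)

closure-closed : ∀ {C D} Cs → D ∈ closure Cs → C ∈ subconcepts D → C ∈ closure Cs
closure-closed Cs D∈ C∈D =
  let E , E∈Cs , D∈E = find (∈-concatMap⁻ subconcepts {xs = Cs} D∈)
  in ∈-concatMap⁺ subconcepts (lose E∈Cs (subconcepts-trans E C∈D D∈E))

record Homomorphism (I J : Interpretation) : Set where
  field
    hom      : Δ I → Δ J
    hom-ind  : ∀ a → hom (ind I a) ≡ ind J a
    hom-conc : ∀ {A d} → conc I A d → conc J A (hom d)
    hom-role : ∀ {R d e} → role I R d e → role J R (hom d) (hom e)

SatCQ-hom : ∀ {I J} → Homomorphism I J → ∀ {n} (q : CQ n) {a} → SatCQ I q a → SatCQ J q a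
SatCQ-hom {I} {J} h q {a} (π , sat) = (λ y → hom (π y)) , All.map (λ {α} → preserve {α}) sat
  where
    open Homomorphism h

    hom-val : ∀ z → hom (val I a π z) ≡ val J a (λ y → hom (π y)) z
    hom-val (inj₁ x) = hom-ind (a x)
    hom-val (inj₂ y) = refl

    preserve : ∀ {α} → SatAtom I a π α → SatAtom J a (λ y → hom (π y)) α
    preserve {cAt A z}    s = subst (conc J A) (hom-val z) (hom-conc s)
    preserve {rAt R z z′} s = subst₂ (role J R) (hom-val z) (hom-val z′) (hom-role s)

module HornCanonicalModel (𝒯 : TBox) (𝒜 : ABox) where

  K : KB
  K = ⟨ 𝒯 , 𝒜 ⟩

  sides : Concept × Concept → List Concept
  sides (C , D) = C ∷ D ∷ []

  conceptsOf : Assertion → List Concept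
  conceptsOf (cAss A _)   = [ atom A ]
  conceptsOf (rAss _ _ _) = []

  individualsOf : Assertion → List IndName
  individualsOf (cAss _ a)   = [ a ]
  individualsOf (rAss _ a b) = a ∷ b ∷ []

  seeds : List Concept
  seeds = ⊤ᶜ ∷ concatMap sides 𝒯 ++ concatMap conceptsOf 𝒜

  U : List Concept
  U = closure seeds

  ⊤∈U : ⊤ᶜ ∈ U
  ⊤∈U = ⊆-closure seeds (here refl)

  side∈U : ∀ {C D E} → (C , D) ∈ 𝒯 → E ∈ sides (C , D) → E ∈ U
  side∈U C⊑D E∈CD = ⊆-closure seeds (there (∈-++⁺ˡ (∈-concatMap⁺ sides (lose C⊑D E∈CD))))

  lhs∈U : ∀ {C D} → (C , D) ∈ 𝒯 → C ∈ U
  lhs∈U C⊑D = side∈U C⊑D (here refl)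

  rhs∈U : ∀ {C D} → (C , D) ∈ 𝒯 → D ∈ U
  rhs∈U C⊑D = side∈U C⊑D (there (here refl))

  atom∈U : ∀ {A a} → cAss A a ∈ 𝒜 → atom A ∈ U
  atom∈U A[a] = ⊆-closure seeds
    (there (∈-++⁺ʳ (concatMap sides 𝒯) (∈-concatMap⁺ conceptsOf (lose A[a] (here refl)))))

  ⊓ˡ∈U : ∀ {C D} → C ⊓ D ∈ U → C ∈ U
  ⊓ˡ∈U C⊓D∈U = closure-closed seeds C⊓D∈U (there (here refl))

  ⊓ʳ∈U : ∀ {C D} → C ⊓ D ∈ U → D ∈ U
  ⊓ʳ∈U {C} C⊓D∈U = closure-closed seeds C⊓D∈U (there (∈-++⁺ʳ (subconcepts C) (here refl)))

  ∃∈U : ∀ {R C} → ∃ᶜ R C ∈ U → C ∈ U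
  ∃∈U ∃RC∈U = closure-closed seeds ∃RC∈U (there (here refl))

  ¬∈U : ∀ {C} → ¬ᶜ C ∈ U → C ∈ U
  ¬∈U ¬C∈U = closure-closed seeds ¬C∈U (there (here refl))

  inds : List IndName
  inds = concatMap individualsOf 𝒜

  asserted-ind : ∀ {A a} → cAss A a ∈ 𝒜 → a ∈ inds
  asserted-ind A[a] = ∈-concatMap⁺ individualsOf (lose A[a] (here refl))

  subject-ind : ∀ {R a b} → rAss R a b ∈ 𝒜 → a ∈ inds
  subject-ind R[a,b] = ∈-concatMap⁺ individualsOf (lose R[a,b] (here refl))

  object-ind : ∀ {R a b} → rAss R a b ∈ 𝒜 → b ∈ inds
  object-ind R[a,b] = ∈-concatMap⁺ individualsOf (lose R[a,b] (there (here refl)))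

  -- inj₁ D is an anonymous element about which nothing but D is known.
  Node : Set
  Node = Concept ⊎ IndName

  Nodes : List Node
  Nodes = map inj₁ U ++ map inj₂ inds

  anonymous∈Nodes : ∀ {D} → D ∈ U → inj₁ D ∈ Nodes
  anonymous∈Nodes D∈U = ∈-++⁺ˡ (∈-map⁺ inj₁ D∈U)

  named∈Nodes : ∀ {a} → a ∈ inds → inj₂ a ∈ Nodes
  named∈Nodes a∈inds = ∈-++⁺ʳ (map inj₁ U) (∈-map⁺ inj₂ a∈inds)

  Fact : Set
  Fact = Node × Concept

  _≟ᶠ_ : DecidableEquality Fact
  _≟ᶠ_ = Σₚ.≡-dec (⊎ₚ.≡-dec _≟ᶜ_ ℕ._≟_) _≟ᶜ_

  Facts : List Fact
  Facts = cartesianProduct Nodes U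

  Realises : (I : Interpretation) → Node → Δ I → Set
  Realises I (inj₁ D) e = ⟦ D ⟧ I e
  Realises I (inj₂ a) e = e ≡ ind I a

  Entailed : Fact → Set₁
  Entailed (n , C) = ∀ I → ModelOf I K → ∀ {e} → Realises I n e → ⟦ C ⟧ I e

  Asserted : Node → Concept → Set
  Asserted (inj₂ a) (atom A) = cAss A a ∈ 𝒜
  Asserted (inj₁ _) _        = ⊥
  Asserted (inj₂ _) ⊤ᶜ       = ⊥
  Asserted (inj₂ _) (¬ᶜ _)   = ⊥
  Asserted (inj₂ _) (_ ⊓ _)  = ⊥
  Asserted (inj₂ _) (∃ᶜ _ _) = ⊥

  asserted? : ∀ n C → Dec (Asserted n C)
  asserted? (inj₂ a) (atom A) = cAss A a ∈ᵃ? 𝒜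
  asserted? (inj₁ _) _        = no λ ()
  asserted? (inj₂ _) ⊤ᶜ       = no λ ()
  asserted? (inj₂ _) (¬ᶜ _)   = no λ ()
  asserted? (inj₂ _) (_ ⊓ _)  = no λ ()
  asserted? (inj₂ _) (∃ᶜ _ _) = no λ ()

  asserted-sound : ∀ n C → Asserted n C → Entailed (n , C)
  asserted-sound (inj₂ a) (atom A) A[a] I m refl = All.lookup (proj₂ m) A[a]

  module _ (S : Fact → Bool) where

    AssertedSuccessor : Node → RoleName → Concept → Set
    AssertedSuccessor (inj₁ _) _ _ = ⊥
    AssertedSuccessor (inj₂ a) R C = Any (λ b → rAss R a b ∈ 𝒜 × T (S (inj₂ b , C))) inds

    Introduced : Node → Concept → Set
    Introduced n (C ⊓ D)  = T (S (n , C)) × T (S (n , D))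
    Introduced n (∃ᶜ R C) =
      Any (λ D → T (S (n , ∃ᶜ R D)) × T (S (inj₁ D , C))) U ⊎ AssertedSuccessor n R C
    Introduced _ ⊤ᶜ       = ⊥
    Introduced _ (atom _) = ⊥
    Introduced _ (¬ᶜ _)   = ⊥

    -- One rule application: premise-free facts, TBox inclusions, ⊓-elimination,
    -- and introduction of ⊓ and ∃.  Premises range over U, so this is decidable.
    Derivable : Fact → Set
    Derivable (n , C) =
        (C ≡ ⊤ᶜ ⊎ n ≡ inj₁ C ⊎ Asserted n C)
      ⊎ Any (λ ax → proj₂ ax ≡ C × T (S (n , proj₁ ax))) 𝒯
      ⊎ Any (λ D → T (S (n , C ⊓ D)) ⊎ T (S (n , D ⊓ C))) U
      ⊎ Introduced n C

    introduced? : ∀ n C → Dec (Introduced n C)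
    introduced? n (C ⊓ D)  = T? (S (n , C)) ×-dec T? (S (n , D))
    introduced? n (∃ᶜ R C) =
      any? (λ D → T? (S (n , ∃ᶜ R D)) ×-dec T? (S (inj₁ D , C))) U ⊎-dec assertedSuccessor? n
      where
        assertedSuccessor? : ∀ n → Dec (AssertedSuccessor n R C)
        assertedSuccessor? (inj₁ _) = no λ ()
        assertedSuccessor? (inj₂ a) =
          any? (λ b → (rAss R a b ∈ᵃ? 𝒜) ×-dec T? (S (inj₂ b , C))) inds
    introduced? _ ⊤ᶜ       = no λ ()
    introduced? _ (atom _) = no λ ()
    introduced? _ (¬ᶜ _)   = no λ ()

    derivable? : ∀ x → Dec (Derivable x)
    derivable? (n , C) =
        ((C ≟ᶜ ⊤ᶜ) ⊎-dec (n ≟ⁿ inj₁ C) ⊎-dec asserted? n C)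
      ⊎-dec any? (λ ax → (proj₂ ax ≟ᶜ C) ×-dec T? (S (n , proj₁ ax))) 𝒯
      ⊎-dec any? (λ D → T? (S (n , C ⊓ D)) ⊎-dec T? (S (n , D ⊓ C))) U
      ⊎-dec introduced? n C
      where _≟ⁿ_ = ⊎ₚ.≡-dec _≟ᶜ_ ℕ._≟_

  module Rules (S : Fact → Bool) where

    top : ∀ {n} → Derivable S (n , ⊤ᶜ)
    top = inj₁ (inj₁ refl)

    self : ∀ {C} → Derivable S (inj₁ C , C)
    self = inj₁ (inj₂ (inj₁ refl))

    assertion : ∀ {A a} → cAss A a ∈ 𝒜 → Derivable S (inj₂ a , atom A)
    assertion A[a] = inj₁ (inj₂ (inj₂ A[a]))

    axiom : ∀ {n C D} → (C , D) ∈ 𝒯 → T (S (n , C)) → Derivable S (n , D)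
    axiom C⊑D s = inj₂ (inj₁ (lose C⊑D (refl , s)))

    ⊓-elimˡ : ∀ {n C D} → D ∈ U → T (S (n , C ⊓ D)) → Derivable S (n , C)
    ⊓-elimˡ D∈U s = inj₂ (inj₂ (inj₁ (lose D∈U (inj₁ s))))

    ⊓-elimʳ : ∀ {n C D} → C ∈ U → T (S (n , C ⊓ D)) → Derivable S (n , D)
    ⊓-elimʳ C∈U s = inj₂ (inj₂ (inj₁ (lose C∈U (inj₂ s))))

    ⊓-intro : ∀ {n C D} → T (S (n , C)) → T (S (n , D)) → Derivable S (n , C ⊓ D)
    ⊓-intro s t = inj₂ (inj₂ (inj₂ (s , t)))

    ∃-intro : ∀ {n R C D} → D ∈ U → T (S (n , ∃ᶜ R D)) → T (S (inj₁ D , C)) →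
              Derivable S (n , ∃ᶜ R C)
    ∃-intro D∈U s t = inj₂ (inj₂ (inj₂ (inj₁ (lose D∈U (s , t)))))

    ∃-introᴬ : ∀ {R a b C} → rAss R a b ∈ 𝒜 → T (S (inj₂ b , C)) →
               Derivable S (inj₂ a , ∃ᶜ R C)
    ∃-introᴬ R[a,b] s = inj₂ (inj₂ (inj₂ (inj₂ (lose (object-ind R[a,b]) (R[a,b] , s)))))

  Sound : (Fact → Bool) → Set₁
  Sound S = ∀ x → T (S x) → Entailed x

  introduced-sound : ∀ {S} → Sound S → ∀ n C → Introduced S n C → Entailed (n , C)
  introduced-sound sound n (C ⊓ D) (s , t) I m r = sound _ s I m r , sound _ t I m r
  introduced-sound sound n (∃ᶜ R C) (inj₁ w) I m r with find w
  ... | D , _ , s , t with sound _ s I m r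
  ...   | e′ , Re′ , De′ = e′ , Re′ , sound _ t I m De′
  introduced-sound sound (inj₂ a) (∃ᶜ R C) (inj₂ w) I m refl with find w
  ... | b , _ , R[a,b] , s = ind I b , All.lookup (proj₂ m) R[a,b] , sound _ s I m refl

  derivable-sound : ∀ {S} → Sound S → ∀ x → Derivable S x → Entailed x
  derivable-sound _ _ (inj₁ (inj₁ refl))             I m r = tt
  derivable-sound _ _ (inj₁ (inj₂ (inj₁ refl)))      I m r = r
  derivable-sound _ (n , C) (inj₁ (inj₂ (inj₂ A[a]))) = asserted-sound n C A[a]
  derivable-sound sound _ (inj₂ (inj₁ ax)) I m r with find ax
  ... | (C , D) , C⊑D , refl , s = All.lookup (proj₁ m) C⊑D _ (sound _ s I m r)
  derivable-sound sound _ (inj₂ (inj₂ (inj₁ el))) I m r with find el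
  ... | _ , _ , inj₁ s = proj₁ (sound _ s I m r)
  ... | _ , _ , inj₂ s = proj₂ (sound _ s I m r)
  derivable-sound sound (n , C) (inj₂ (inj₂ (inj₂ intro))) = introduced-sound sound n C intro

  open Saturation _≟ᶠ_ Facts Derivable derivable? using (S*; S*-closed; S*-induction)

  S*-sound : Sound S*
  S*-sound = S*-induction Entailed (λ _ sound _ → derivable-sound sound _)

  S*⊆Facts : ∀ x → T (S* x) → x ∈ Facts
  S*⊆Facts = S*-induction (_∈ Facts) (λ _ _ x∈Facts _ → x∈Facts)

  module Unravelling (S : Fact → Bool)
                     (S-closed : ∀ {x} → x ∈ Facts → Derivable S x → T (S x))
                     (S-sound : Sound S)
                     (S⊆Facts : ∀ x → T (S x) → x ∈ Facts) where

    open Rules S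

    derive : ∀ {n C} → n ∈ Nodes → C ∈ U → Derivable S (n , C) → T (S (n , C))
    derive n∈Nodes C∈U = S-closed (∈-cartesianProduct⁺ n∈Nodes C∈U)

    S⇒∈U : ∀ {n C} → T (S (n , C)) → C ∈ U
    S⇒∈U s = proj₂ (∈-cartesianProduct⁻ Nodes U (S⊆Facts _ s))

    S-resp : ∀ {n n′ C} → n ≡ n′ → T (S (n , C)) → T (S (n′ , C))
    S-resp refl s = s

    -- (a , [(Rₖ , Dₖ) , … , (R₁ , D₁)]) is reached from a along ∃R₁.D₁, …, ∃Rₖ.Dₖ.
    Path : Set
    Path = IndName × List (RoleName × Concept)

    -- Roots outside the ABox and steps along an underived ∃R.D lead to the junk
    -- node ⊤ᶜ; such paths are unreachable but must still satisfy the TBox.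
    rootNode : IndName → Node
    rootNode a = if isYes (a ∈ⁱ? inds) then inj₂ a else inj₁ ⊤ᶜ

    childNode : Node → RoleName → Concept → Node
    childNode n R D = if S (n , ∃ᶜ R D) then inj₁ D else inj₁ ⊤ᶜ

    node : Path → Node
    node (a , [])          = rootNode a
    node (a , (R , D) ∷ p) = childNode (node (a , p)) R D

    rootNode-named : ∀ {a} → a ∈ inds → rootNode a ≡ inj₂ a
    rootNode-named {a} a∈inds with a ∈ⁱ? inds
    ... | yes _     = refl
    ... | no a∉inds = ⊥-elim (a∉inds a∈inds)

    childNode-witness : ∀ {n R D} → T (S (n , ∃ᶜ R D)) → childNode n R D ≡ inj₁ D
    childNode-witness {n} {R} {D} s with S (n , ∃ᶜ R D)
    ... | true = refl

    node∈Nodes : ∀ d → node d ∈ Nodes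
    node∈Nodes (a , []) with a ∈ⁱ? inds
    ... | yes a∈inds = named∈Nodes a∈inds
    ... | no _       = anonymous∈Nodes ⊤∈U
    node∈Nodes (a , (R , D) ∷ p)
      with S (node (a , p) , ∃ᶜ R D) | S⇒∈U {node (a , p)} {∃ᶜ R D}
    ... | true  | ∃RD∈U = anonymous∈Nodes (∃∈U (∃RD∈U tt))
    ... | false | _     = anonymous∈Nodes ⊤∈U

    data Succ (R : RoleName) : Path → Path → Set where
      witness  : ∀ {a p D} → T (S (node (a , p) , ∃ᶜ R D)) → Succ R (a , p) (a , (R , D) ∷ p)
      asserted : ∀ {a b} → rAss R a b ∈ 𝒜 → Succ R (a , []) (b , [])

    M : Interpretation
    M = record
      { Δ             = Path
      ; conc          = λ A d → T (S (node d , atom A))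
      ; role          = Succ
      ; ind           = λ a → a , []
      ; ind-injective = cong proj₁
      }

    WitnessSucc : (Path → Set) → RoleName → Path → Set
    WitnessSucc P R (a , p) = Any (λ D → T (S (node (a , p) , ∃ᶜ R D)) × P (a , (R , D) ∷ p)) U

    AssertedSucc : (Path → Set) → RoleName → Path → Set
    AssertedSucc P R (a , [])    = Any (λ b → rAss R a b ∈ 𝒜 × P (b , [])) inds
    AssertedSucc P R (_ , _ ∷ _) = ⊥

    succ-split : ∀ {P R d} → ∃[ e ] (Succ R d e × P e) →
                 WitnessSucc P R d ⊎ AssertedSucc P R d
    succ-split (_ , witness s , Pe)       = inj₁ (lose (∃∈U (S⇒∈U s)) (s , Pe))
    succ-split (_ , asserted R[a,b] , Pe) = inj₂ (lose (object-ind R[a,b]) (R[a,b] , Pe))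

    succ-join : ∀ {P R} d → WitnessSucc P R d ⊎ AssertedSucc P R d → ∃[ e ] (Succ R d e × P e)
    succ-join _        (inj₁ w) = let _ , _ , s , Pe = find w in _ , witness s , Pe
    succ-join (_ , []) (inj₂ w) = let _ , _ , R[a,b] , Pe = find w in _ , asserted R[a,b] , Pe

    succ? : ∀ {P} → (∀ d → Dec (P d)) → ∀ R d → Dec (∃[ e ] (Succ R d e × P e))
    succ? {P} P? R d = map′ (succ-join d) succ-split (witness? d ⊎-dec assertedSucc? d)
      where
        witness? : ∀ d → Dec (WitnessSucc P R d)
        witness? (a , p) =
          any? (λ D → T? (S (node (a , p) , ∃ᶜ R D)) ×-dec P? (a , (R , D) ∷ p)) U

        assertedSucc? : ∀ d → Dec (AssertedSucc P R d)
        assertedSucc? (a , [])    = any? (λ b → (rAss R a b ∈ᵃ? 𝒜) ×-dec P? (b , [])) inds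
        assertedSucc? (_ , _ ∷ _) = no λ ()

    ⟦_⟧?_ : ∀ C d → Dec (⟦ C ⟧ M d)
    ⟦ ⊤ᶜ ⟧? d     = yes tt
    ⟦ atom A ⟧? d = T? (S (node d , atom A))
    ⟦ ¬ᶜ C ⟧? d   = ¬? (⟦ C ⟧? d)
    ⟦ C ⊓ D ⟧? d  = ⟦ C ⟧? d ×-dec ⟦ D ⟧? d
    ⟦ ∃ᶜ R C ⟧? d = succ? (⟦ C ⟧?_) R d

    classical : Classical M
    classical C d with ⟦ C ⟧? d
    ... | yes Cd = inj₁ Cd
    ... | no ¬Cd = inj₂ ¬Cd

    module _ (I : Interpretation) (m : ModelOf I K) where

      root-realised : ∀ a → Realises I (rootNode a) (ind I a)
      root-realised a with a ∈ⁱ? inds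
      ... | yes _ = refl
      ... | no _  = tt

      child-realised : ∀ {n} R D {e} → Realises I n e →
        Σ (Δ I) λ e′ → Realises I (childNode n R D) e′ ×
                       (T (S (n , ∃ᶜ R D)) → role I R e e′)
      child-realised {n} R D r with S (n , ∃ᶜ R D) | S-sound (n , ∃ᶜ R D)
      ... | true  | sound = let e′ , Re′ , De′ = sound tt I m r in e′ , De′ , λ _ → Re′
      ... | false | _     = ind I 0 , tt , λ ()

      realise : ∀ d → Σ (Δ I) (Realises I (node d))
      realise (a , [])          = ind I a , root-realised a
      realise (a , (R , D) ∷ p) = Σ.map₂ proj₁ (child-realised R D (proj₂ (realise (a , p))))

      realise-role : ∀ {R d e} → Succ R d e → role I R (proj₁ (realise d)) (proj₁ (realise e))
      realise-role {R} (witness {a} {p} {D} s) =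
        proj₂ (proj₂ (child-realised R D (proj₂ (realise (a , p))))) s
      realise-role (asserted R[a,b])           = All.lookup (proj₂ m) R[a,b]

      homomorphism : Homomorphism M I
      homomorphism = record
        { hom      = proj₁ ∘ realise
        ; hom-ind  = λ _ → refl
        ; hom-conc = λ {_} {d} s → S-sound _ s I m (proj₂ (realise d))
        ; hom-role = realise-role
        }

    ⟦⟧⇒S : ∀ C → HornNeg C → C ∈ U → ∀ d → ⟦ C ⟧ M d → T (S (node d , C))
    ⟦⟧⇒S ⊤ᶜ       _         ⊤∈U   d _         = derive (node∈Nodes d) ⊤∈U top
    ⟦⟧⇒S (atom A) _         _     d Ad        = Ad
    ⟦⟧⇒S (C ⊓ D)  (hC , hD) C⊓D∈U d (Cd , Dd) =
      derive (node∈Nodes d) C⊓D∈U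
        (⊓-intro (⟦⟧⇒S C hC (⊓ˡ∈U C⊓D∈U) d Cd) (⟦⟧⇒S D hD (⊓ʳ∈U C⊓D∈U) d Dd))
    ⟦⟧⇒S (∃ᶜ R C) hC ∃RC∈U d (e , witness s , Ce) =
      derive (node∈Nodes d) ∃RC∈U
        (∃-intro (∃∈U (S⇒∈U s)) s
          (S-resp (childNode-witness s) (⟦⟧⇒S C hC (∃∈U ∃RC∈U) e Ce)))
    ⟦⟧⇒S (∃ᶜ R C) hC ∃RC∈U d (e , asserted R[a,b] , Ce) =
      S-resp (sym (rootNode-named (subject-ind R[a,b])))
        (derive (named∈Nodes (subject-ind R[a,b])) ∃RC∈U
          (∃-introᴬ R[a,b]
            (S-resp (rootNode-named (object-ind R[a,b])) (⟦⟧⇒S C hC (∃∈U ∃RC∈U) e Ce))))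

    module _ (I₀ : Interpretation) (m₀ : ModelOf I₀ K) where

      S⇒⟦⟧ : ∀ C → HornPos C → ∀ d → T (S (node d , C)) → ⟦ C ⟧ M d
      S⇒⟦⟧ ⊤ᶜ       _         _ _ = tt
      S⇒⟦⟧ (atom A) _         _ s = s
      S⇒⟦⟧ (C ⊓ D)  (hC , hD) d s =
        S⇒⟦⟧ C hC d (derive (node∈Nodes d) C∈U (⊓-elimˡ D∈U s)) ,
        S⇒⟦⟧ D hD d (derive (node∈Nodes d) D∈U (⊓-elimʳ C∈U s))
        where
          C∈U = ⊓ˡ∈U (S⇒∈U s)
          D∈U = ⊓ʳ∈U (S⇒∈U s)
      S⇒⟦⟧ (∃ᶜ R D) (_ , hD) (a , p) s =
        (a , (R , D) ∷ p) , witness s ,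
        S⇒⟦⟧ D hD _
          (S-resp (sym (childNode-witness s)) (derive (anonymous∈Nodes D∈U) D∈U self))
        where D∈U = ∃∈U (S⇒∈U s)
      -- If C held at d in M, it would be derived at node d as well; but facts derived
      -- at node d hold at its realisation in the model I₀, where ¬C and C clash.
      S⇒⟦⟧ (¬ᶜ C) hC d s Cd =
        S-sound _ s I₀ m₀ r (S-sound _ (⟦⟧⇒S C hC (¬∈U (S⇒∈U s)) d Cd) I₀ m₀ r)
        where r = proj₂ (realise I₀ m₀ d)

      isModel : HornTBox 𝒯 → ModelOf M K
      isModel horn =
        All.tabulate (λ { {C , D} C⊑D → inclusion C⊑D (All.lookup horn C⊑D) }) ,
        All.tabulate (λ {α} → assertion-holds {α})
        where
          inclusion : ∀ {C D} → (C , D) ∈ 𝒯 → HornNeg C × HornPos D →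
                      ∀ d → ⟦ C ⟧ M d → ⟦ D ⟧ M d
          inclusion C⊑D (hC , hD) d Cd = S⇒⟦⟧ _ hD d
            (derive (node∈Nodes d) (rhs∈U C⊑D) (axiom C⊑D (⟦⟧⇒S _ hC (lhs∈U C⊑D) d Cd)))

          assertion-holds : ∀ {α} → α ∈ 𝒜 → SatAssertion M α
          assertion-holds {cAss A a}   A[a]   =
            S-resp (sym (rootNode-named (asserted-ind A[a])))
              (derive (named∈Nodes (asserted-ind A[a])) (atom∈U A[a]) (assertion A[a]))
          assertion-holds {rAss R a b} R[a,b] = asserted R[a,b]

  open Unravelling S* S*-closed S*-sound S*⊆Facts public

record CanonicalModel (K : KB) : Set₁ where
  field
    model        : Interpretation
    classical    : Classical model
    isModel      : ModelOf model K
    homomorphism : ∀ I → ModelOf I K → Homomorphism model I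

-- Opaque so that type checking never unfolds the saturation behind the model.
opaque
  horn-canonicalModel : ∀ K → Consistent K → HornTBox (tbox K) → CanonicalModel K
  horn-canonicalModel ⟨ 𝒯 , 𝒜 ⟩ (I₀ , _ , I₀⊨K) horn = record
    { model        = M
    ; classical    = classical
    ; isModel      = isModel I₀ I₀⊨K horn
    ; homomorphism = homomorphism
    }
    where open HornCanonicalModel 𝒯 𝒜

horn-disjunction : ∀ {K n} → Consistent K → HornTBox (tbox K) →
                   (q : UCQ n) {a : Fin n → IndName} →
                   K ⊨[ ucq ] q at a → Any (λ c → K ⊨[ cq ] c at a) (toList q)
horn-disjunction K-consistent horn q K⊨q =
  Any.map (λ {c} M⊨c I _ I⊨K → SatCQ-hom (homomorphism I I⊨K) c M⊨c)
          (K⊨q model classical isModel)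
  where open CanonicalModel (horn-canonicalModel _ K-consistent horn)

module _ {K : KB} {n} {a : Fin n → IndName} where

  ⊨-singleton : {q : CQ n} → K ⊨[ cq ] q at a → K ⊨[ ucq ] [ q ]⁺ at a
  ⊨-singleton K⊨q I cl I⊨K = singleton⁺ (K⊨q I cl I⊨K)

  ⊨-singleton⁻ : {q : CQ n} → K ⊨[ ucq ] [ q ]⁺ at a → K ⊨[ cq ] q at a
  ⊨-singleton⁻ K⊨q I cl I⊨K = singleton⁻ (K⊨q I cl I⊨K)

  ⊨-disjunct : {q : UCQ n} {c : CQ n} → c ∈ toList q → K ⊨[ cq ] c at a → K ⊨[ ucq ] q at a
  ⊨-disjunct c∈q K⊨c I cl I⊨K = lose c∈q (K⊨c I cl I⊨K)

module _ {K₁ K₂ : KB} {S : Signature} where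

  ucq⇒cq : KBEntails ucq K₁ S K₂ → KBEntails cq K₁ S K₂
  ucq⇒cq H q q∈S a a∈K₂ K₂⊨q =
    Σ.map₂ ⊨-singleton⁻ (H [ q ]⁺ (q∈S ∷ []) a a∈K₂ (⊨-singleton K₂⊨q))

  rucq⇒rcq : KBEntails rucq K₁ S K₂ → KBEntails rcq K₁ S K₂
  rucq⇒rcq H (q , rooted) q∈S a a∈K₂ K₂⊨q =
    Σ.map₂ ⊨-singleton⁻ (H ([ q ]⁺ , rooted ∷ []) (q∈S ∷ []) a a∈K₂ (⊨-singleton K₂⊨q))

  module _ (K₂-consistent : Consistent K₂) (horn : HornTBox (tbox K₂)) where

    cq⇒ucq : KBEntails cq K₁ S K₂ → KBEntails ucq K₁ S K₂
    cq⇒ucq H q q∈S a a∈K₂ K₂⊨q with find (horn-disjunction K₂-consistent horn q K₂⊨q)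
    ... | c , c∈q , K₂⊨c =
      Σ.map₂ (⊨-disjunct c∈q) (H c (All.lookup q∈S c∈q) a a∈K₂ K₂⊨c)

    rcq⇒rucq : KBEntails rcq K₁ S K₂ → KBEntails rucq K₁ S K₂
    rcq⇒rucq H (q , rooted) q∈S a a∈K₂ K₂⊨q
      with find (horn-disjunction K₂-consistent horn q K₂⊨q)
    ... | c , c∈q , K₂⊨c =
      Σ.map₂ (⊨-disjunct c∈q)
             (H (c , All.lookup rooted c∈q) (All.lookup q∈S c∈q) a a∈K₂ K₂⊨c)

ucq⇔cq : ∀ {K₁ K₂ S} → Consistent K₂ → HornTBox (tbox K₂) →
         KBEntails ucq K₁ S K₂ ⇔ KBEntails cq K₁ S K₂
ucq⇔cq K₂-consistent horn = mk⇔ ucq⇒cq (cq⇒ucq K₂-consistent horn)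

rucq⇔rcq : ∀ {K₁ K₂ S} → Consistent K₂ → HornTBox (tbox K₂) →
           KBEntails rucq K₁ S K₂ ⇔ KBEntails rcq K₁ S K₂
rucq⇔rcq K₂-consistent horn = mk⇔ rucq⇒rcq (rcq⇒rucq K₂-consistent horn)

TBoxEntails-map : ∀ {Q Q′} T₁ T₂ S₁ S₂ →
  (∀ 𝒜 → Consistent ⟨ T₂ , 𝒜 ⟩ →
     KBEntails Q ⟨ T₁ , 𝒜 ⟩ S₂ ⟨ T₂ , 𝒜 ⟩ → KBEntails Q′ ⟨ T₁ , 𝒜 ⟩ S₂ ⟨ T₂ , 𝒜 ⟩) →
  TBoxEntails Q T₁ (S₁ , S₂) T₂ → TBoxEntails Q′ T₁ (S₁ , S₂) T₂
TBoxEntails-map _ _ _ _ f H 𝒜 𝒜∈S₁ consistent₁ consistent₂ =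
  f 𝒜 consistent₂ (H 𝒜 𝒜∈S₁ consistent₁ consistent₂)

TBox-ucq⇔cq : ∀ T₁ T₂ S₁ S₂ → HornTBox T₂ →
              TBoxEntails ucq T₁ (S₁ , S₂) T₂ ⇔ TBoxEntails cq T₁ (S₁ , S₂) T₂
TBox-ucq⇔cq T₁ T₂ S₁ S₂ horn = mk⇔
  (TBoxEntails-map T₁ T₂ S₁ S₂ λ _ _ → ucq⇒cq)
  (TBoxEntails-map T₁ T₂ S₁ S₂ λ _ consistent → cq⇒ucq consistent horn)

TBox-rucq⇔rcq : ∀ T₁ T₂ S₁ S₂ → HornTBox T₂ →
                TBoxEntails rucq T₁ (S₁ , S₂) T₂ ⇔ TBoxEntails rcq T₁ (S₁ , S₂) T₂
TBox-rucq⇔rcq T₁ T₂ S₁ S₂ horn = mk⇔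
  (TBoxEntails-map {rucq} {rcq} T₁ T₂ S₁ S₂ λ _ _ → rucq⇒rcq)
  (TBoxEntails-map {rcq} {rucq} T₁ T₂ S₁ S₂ λ _ consistent → rcq⇒rucq consistent horn)

theorem1 :
    ((K₁ K₂ : KB) (S : Signature) →
      Consistent K₁ → Consistent K₂ → HornTBox (tbox K₂) →
      (KBEntails ucq K₁ S K₂ ⇔ KBEntails cq K₁ S K₂)
      × (KBEntails rucq K₁ S K₂ ⇔ KBEntails rcq K₁ S K₂))
    ×
    ((T₁ T₂ : TBox) (Θ : Signature × Signature) →
      HornTBox T₂ →
      (TBoxEntails ucq T₁ Θ T₂ ⇔ TBoxEntails cq T₁ Θ T₂)
      × (TBoxEntails rucq T₁ Θ T₂ ⇔ TBoxEntails rcq T₁ Θ T₂))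
theorem1 =
  (λ _ _ _ _ K₂-consistent horn → ucq⇔cq K₂-consistent horn , rucq⇔rcq K₂-consistent horn) ,
  (λ T₁ T₂ (S₁ , S₂) horn →
     TBox-ucq⇔cq T₁ T₂ S₁ S₂ horn , TBox-rucq⇔rcq T₁ T₂ S₁ S₂ horn)
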